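{- For every even binary word $W$ there exists a cyclic permutation $\gamma$ such that $W$ is a shuffle $\gamma$-square.
   Context: A word is a finite sequence of letters; a binary word uses the alphabet $\{\mathtt{0},\mathtt{1}\}$. A word is \emph{even} if every letter occurs in it an even number of times. A \emph{subword} of $W$ is a word obtained by deleting some (possibly zero) letters of $W$. For a permutation $\gamma=\gamma_1\gamma_2\cdots\gamma_n$ of $[n]=\{1,\dots,n\}$ (written as a sequence) and a word $W=w_1\cdots w_n$, set $\gamma(W)=w_{\gamma_1}w_{\gamma_2}\cdots w_{\gamma_n}$. Two words $U,V$ of length $n$ are \emph{$\gamma$-similar} if $U=\gamma(V)$ or $V=\gamma(U)$. A word $W$ (of length $2n$) is a \emph{shuffle $\gamma$-square} if its set of positions can be partitioned into two sets such that the two resulting subwords (each of length $n$) are $\gamma$-similar. A permutation $\gamma$ of $[n]$ is \emph{cyclic} if $\gamma=i(i+1)\cdots n\,1\,2\cdots(i-1)$ for some $i\in[n]$. -}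

module Defs where

open import Data.Bool using (Bool; true; false; not)
open import Data.Nat using (ℕ; zero; suc; _+_; _<_; NonZero)
open import Data.Nat.DivMod using (_%_; m%n<n)
open import Data.Fin using (Fin; toℕ; fromℕ<)
open import Data.List using (List; []; _∷_; length; filter)
open import Data.List.Base using (zip; map)
open import Data.Vec using (Vec; lookup; tabulate; fromList)
open import Data.Product using (Σ; ∃; _×_; _,_; proj₁; proj₂)
open import Data.Sum using (_⊎_)
open import Relation.Binary.PropositionalEquality using (_≡_)
open import Relation.Nullary.Decidable using (Dec; yes; no)
open import Data.Nat.Properties using (_≟_)
open import Data.Bool.Properties using () renaming (_≟_ to _≟ᵇ_)

Even : ℕ → Set
Even m = Σ ℕ λ k → m ≡ k + k

-- binary words: letters 0 ↦ false, 1 ↦ true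
BinWord : Set
BinWord = List Bool

occ : Bool → BinWord → ℕ
occ b w = length (filter (λ x → x ≟ᵇ b) w)

EvenWord : BinWord → Set
EvenWord w = (b : Bool) → Even (occ b w)

-- a permutation of [n] as a sequence γ₁…γₙ, 0-indexed: Fin n → Fin n
Perm : ℕ → Set
Perm n = Fin n → Fin n

-- the cyclic permutation  i (i+1) ⋯ n 1 ⋯ (i-1), 0-indexed: k ↦ (s + k) mod n, s = i - 1
rot : (n : ℕ) → ℕ → Perm n
rot zero s ()
rot (suc n) s k = fromℕ< (m%n<n (s + toℕ k) (suc n))

-- γ is cyclic (any shift s; shifts are taken mod n, so this is exactly the set of
-- cyclic permutations, and for n = 0 the empty permutation counts as cyclic)
Cyclic : (n : ℕ) → Perm n → Set
Cyclic n γ = Σ ℕ λ s → (k : Fin n) → γ k ≡ rot n s k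

applyPerm : {n : ℕ} → Perm n → Vec Bool n → Vec Bool n
applyPerm γ w = tabulate (λ k → lookup w (γ k))

Similar : {n : ℕ} → Perm n → Vec Bool n → Vec Bool n → Set
Similar γ U V = U ≡ applyPerm γ V ⊎ V ≡ applyPerm γ U

-- the subword of W consisting of the positions where the mask equals b
-- (a partition of the positions into two sets is given by a mask of the same length)
select : Bool → List Bool → BinWord → BinWord
select b [] _ = []
select b (_ ∷ _) [] = []
select b (m ∷ ms) (x ∷ xs) with m ≟ᵇ b
... | yes _ = x ∷ select b ms xs
... | no _ = select b ms xs

ShuffleSquare : (n : ℕ) → Perm n → BinWord → Set
ShuffleSquare n γ W =
  length W ≡ n + n ×
  Σ (List Bool) λ mask → length mask ≡ length W ×
    Σ (length (select true mask W) ≡ n) λ p →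
    Σ (length (select false mask W) ≡ n) λ q →
      Similar γ (cast p (fromList (select true mask W)))
                (cast q (fromList (select false mask W)))
  where open import Data.Vec using (cast)

-- Let W have 2a zeros and 2b ones and put n = a + b. As i runs from 0 to n, the number of zeros
-- in the factor of length n starting at i changes by at most one per step, and the factors at
-- 0 and n together contain all 2a zeros; so some factor Y, with W = X Y Z, has exactly a zeros
-- and b ones. Split W into U = (zeros of X)(ones of Y)(zeros of Z) and V = (ones of X)(zeros
-- of Y)(ones of Z): then U = 0^t 1^b 0^y and V = 1^r 0^a 1^w with t + y = a and r + w = b, so
-- U is V rotated left by r + y.
module Submission where

open import Defs
open import Data.Nat using (ℕ)
open import Data.Product using (Σ; _×_)

open import Data.Bool using (Bool; true; false; not)
open import Data.Nat using (zero; suc; _+_; _∸_; _⊓_; _≤_; _<_; z≤n; s≤s; _<?_; _≤?_; NonZero)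
open import Data.Nat.Properties
open import Data.Nat.DivMod using (_%_; m%n<n; m<n⇒m%n≡m; m≤n⇒[n∸m]%m≡n%m)
open import Data.Nat.Tactic.RingSolver using (solve-∀)
open import Data.Fin using (Fin; toℕ)
open import Data.Fin.Properties using (toℕ-fromℕ<; toℕ<n)
open import Data.List using (List; []; _∷_; length; filter; _++_; take; drop; replicate; map)
open import Data.List.Properties
  using (length-++; length-map; length-take; length-drop; length-replicate; length-filter; filter-++;
         take++drop≡id; take-all; ++-assoc)
open import Data.Vec using (lookup; tabulate; fromList; cast)
open import Data.Vec.Properties using (tabulate-cong; tabulate∘lookup)
open import Data.Product using (∃-syntax; _,_)
import Data.Product as Product
open import Data.Sum using (inj₁)
open import Function using (_∘_)
open import Relation.Binary.PropositionalEquality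
open import Relation.Nullary using (Dec; yes; no)
open import Data.Bool.Properties using () renaming (_≟_ to _≟ᵇ_)
open import Algebra.Properties.CommutativeSemigroup +-commutativeSemigroup using (interchange; x∙yz≈y∙xz)

private
  variable
    A : Set

occ-++ : ∀ b xs ys → occ b (xs ++ ys) ≡ occ b xs + occ b ys
occ-++ b xs ys = trans (cong length (filter-++ (_≟ᵇ b) xs ys)) (length-++ (filter (_≟ᵇ b) xs))

length≡occ+occ : ∀ w → length w ≡ occ false w + occ true w
length≡occ+occ [] = refl
length≡occ+occ (false ∷ w) = cong suc (length≡occ+occ w)
length≡occ+occ (true ∷ w) = trans (cong suc (length≡occ+occ w)) (sym (+-suc _ _))

take-+ : ∀ m n (xs : List A) → take (m + n) xs ≡ take m xs ++ take n (drop m xs)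
take-+ zero n xs = refl
take-+ (suc m) zero [] = refl
take-+ (suc m) (suc n) [] = refl
take-+ (suc m) n (x ∷ xs) = cong (x ∷_) (take-+ m n xs)

occ-take-suc : ∀ b k w → occ b (take (suc k) w) ≡ occ b (take k w) + occ b (take 1 (drop k w))
occ-take-suc b k w = begin
  occ b (take (suc k) w)                 ≡⟨ cong (λ j → occ b (take j w)) (+-comm 1 k) ⟩
  occ b (take (k + 1) w)                 ≡⟨ cong (occ b) (take-+ k 1 w) ⟩
  occ b (take k w ++ take 1 (drop k w))  ≡⟨ occ-++ b (take k w) _ ⟩
  occ b (take k w) + occ b (take 1 (drop k w)) ∎
  where open ≡-Reasoning

occ-take-1≤1 : ∀ b w → occ b (take 1 w) ≤ 1
occ-take-1≤1 b [] = z≤n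
occ-take-1≤1 b (x ∷ w) = length-filter (_≟ᵇ b) (x ∷ [])

occ-take-suc≤ : ∀ b k w → occ b (take (suc k) w) ≤ suc (occ b (take k w))
occ-take-suc≤ b k w = begin
  occ b (take (suc k) w)                       ≡⟨ occ-take-suc b k w ⟩
  occ b (take k w) + occ b (take 1 (drop k w)) ≤⟨ +-monoʳ-≤ (occ b (take k w)) (occ-take-1≤1 b (drop k w)) ⟩
  occ b (take k w) + 1                         ≡⟨ +-comm _ 1 ⟩
  suc (occ b (take k w))                       ∎
  where open ≤-Reasoning

occ-take-≤-suc : ∀ b k w → occ b (take k w) ≤ occ b (take (suc k) w)
occ-take-≤-suc b k w =
  ≤-trans (m≤m+n (occ b (take k w)) _) (≤-reflexive (sym (occ-take-suc b k w)))

discrete-intermediate-value : (f g : ℕ → ℕ) → (∀ i → f (suc i) ≤ suc (f i)) → (∀ i → g i ≤ g (suc i)) →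
  ∀ m → f 0 ≤ g 0 → g m ≤ f m → ∃[ i ] i ≤ m × f i ≡ g i
discrete-intermediate-value f g f-slow g-mono zero f≤g g≤f = 0 , z≤n , ≤-antisym f≤g g≤f
discrete-intermediate-value f g f-slow g-mono (suc m) f≤g g≤f with f 0 ≟ g 0
... | yes f≡g = 0 , z≤n , f≡g
... | no f≢g with discrete-intermediate-value (f ∘ suc) (g ∘ suc) (f-slow ∘ suc) (g-mono ∘ suc) m
                  (≤-trans (f-slow 0) (≤-trans (≤∧≢⇒< f≤g f≢g) (g-mono 0))) g≤f
...   | i , i≤m , fi≡gi = suc i , s≤s i≤m , fi≡gi

prefix-counts-meet : ∀ b a n w → length w ≡ n + n → occ b w ≡ a + a →
  ∃[ i ] i ≤ n × occ b (take (i + n) w) ≡ occ b (take i w) + a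
prefix-counts-meet b a n w len occ-w = meet (c n ≤? a)
  where
  c : ℕ → ℕ
  c k = occ b (take k w)
  c-total : c (n + n) ≡ a + a
  c-total = trans (cong (occ b) (take-all (n + n) w (≤-reflexive len))) occ-w
  meet : Dec (c n ≤ a) → ∃[ i ] i ≤ n × c (i + n) ≡ c i + a
  meet (yes cn≤a) = discrete-intermediate-value (λ i → c (i + n)) (λ i → c i + a)
    (λ i → occ-take-suc≤ b (i + n) w) (λ i → +-monoˡ-≤ a (occ-take-≤-suc b i w))
    n cn≤a (subst (c n + a ≤_) (sym c-total) (+-monoˡ-≤ a cn≤a))
  meet (no cn≰a) = Product.map₂ (Product.map₂ sym) (discrete-intermediate-value (λ i → c i + a) (λ i → c (i + n))
    (λ i → +-monoˡ-≤ a (occ-take-suc≤ b i w)) (λ i → occ-take-≤-suc b (i + n) w)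
    n a≤cn (subst (_≤ c n + a) (sym c-total) (+-monoˡ-≤ a a≤cn)))
    where a≤cn = <⇒≤ (≰⇒> cn≰a)

half-window : ∀ b a n w → length w ≡ n + n → occ b w ≡ a + a →
  ∃[ i ] i ≤ n × occ b (take n (drop i w)) ≡ a
half-window b a n w len occ-w with prefix-counts-meet b a n w len occ-w
... | i , i≤n , meets = i , i≤n , +-cancelˡ-≡ (occ b (take i w)) _ _ (begin
  occ b (take i w) + occ b (take n (drop i w)) ≡⟨ occ-++ b (take i w) _ ⟨
  occ b (take i w ++ take n (drop i w))        ≡⟨ cong (occ b) (take-+ i n w) ⟨
  occ b (take (i + n) w)                       ≡⟨ meets ⟩
  occ b (take i w) + a                         ∎)
  where open ≡-Reasoning

Balanced : BinWord → BinWord → BinWord → Set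
Balanced xs ys zs = ∀ b → occ b ys ≡ occ b xs + occ b zs

occ-++₃ : ∀ b xs ys zs → occ b (xs ++ ys ++ zs) ≡ occ b xs + (occ b ys + occ b zs)
occ-++₃ b xs ys zs = trans (occ-++ b xs (ys ++ zs)) (cong (occ b xs +_) (occ-++ b ys zs))

balanced-letter : ∀ b h xs ys zs → occ b (xs ++ ys ++ zs) ≡ h + h → occ b ys ≡ h →
  occ b ys ≡ occ b xs + occ b zs
balanced-letter b _ xs ys zs total refl = +-cancelˡ-≡ (occ b ys) _ _ (begin
  occ b ys + occ b ys                 ≡⟨ total ⟨
  occ b (xs ++ ys ++ zs)              ≡⟨ occ-++₃ b xs ys zs ⟩
  occ b xs + (occ b ys + occ b zs)    ≡⟨ x∙yz≈y∙xz (occ b xs) (occ b ys) (occ b zs) ⟩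
  occ b ys + (occ b xs + occ b zs)    ∎)
  where open ≡-Reasoning

balanced-factorisation : ∀ w → EvenWord w →
  ∃[ xs ] ∃[ ys ] ∃[ zs ] w ≡ xs ++ ys ++ zs × Balanced xs ys zs
balanced-factorisation w even with even false | even true
... | a , zeros | c , ones = factor (half-window false a n w length-w zeros)
  where
  n = a + c
  length-w : length w ≡ n + n
  length-w = trans (length≡occ+occ w) (trans (cong₂ _+_ zeros ones) (interchange a a c c))
  factor : ∃[ i ] i ≤ n × occ false (take n (drop i w)) ≡ a →
    ∃[ xs ] ∃[ ys ] ∃[ zs ] w ≡ xs ++ ys ++ zs × Balanced xs ys zs
  factor (i , i≤n , window-zeros) = take i w , ys , zs , split , balanced
    where
    ys = take n (drop i w)
    zs = drop n (drop i w)
    split : w ≡ take i w ++ ys ++ zs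
    split = sym (trans (cong (take i w ++_) (take++drop≡id n (drop i w))) (take++drop≡id i w))
    n≤rest : n ≤ length (drop i w)
    n≤rest = subst₂ _≤_ (m+n∸n≡m n n) (sym (trans (length-drop i w) (cong (_∸ i) length-w)))
      (∸-monoʳ-≤ (n + n) i≤n)
    window-ones : occ true ys ≡ c
    window-ones = +-cancelˡ-≡ a _ _ (begin
      a + occ true ys                ≡⟨ cong (_+ occ true ys) window-zeros ⟨
      occ false ys + occ true ys     ≡⟨ length≡occ+occ ys ⟨
      length ys                      ≡⟨ length-take n (drop i w) ⟩
      n ⊓ length (drop i w)          ≡⟨ m≤n⇒m⊓n≡m n≤rest ⟩
      a + c                          ∎)
      where open ≡-Reasoning
    balanced : Balanced (take i w) ys zs
    balanced false = balanced-letter false a (take i w) ys zs (subst (λ v → occ false v ≡ a + a) split zeros) window-zeros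
    balanced true = balanced-letter true c (take i w) ys zs (subst (λ v → occ true v ≡ c + c) split ones) window-ones

shuffle-mask : BinWord → BinWord → BinWord → List Bool
shuffle-mask xs ys zs = map not xs ++ ys ++ map not zs

length-shuffle-mask : ∀ xs ys zs → length (shuffle-mask xs ys zs) ≡ length (xs ++ ys ++ zs)
length-shuffle-mask xs ys zs = begin
  length (map not xs ++ ys ++ map not zs)            ≡⟨ length-++ (map not xs) ⟩
  length (map not xs) + length (ys ++ map not zs)    ≡⟨ cong (length (map not xs) +_) (length-++ ys) ⟩
  length (map not xs) + (length ys + length (map not zs))
    ≡⟨ cong₂ (λ p q → p + (length ys + q)) (length-map not xs) (length-map not zs) ⟩
  length xs + (length ys + length zs)                ≡⟨ cong (length xs +_) (length-++ ys) ⟨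
  length xs + length (ys ++ zs)                      ≡⟨ length-++ xs ⟨
  length (xs ++ ys ++ zs)                            ∎
  where open ≡-Reasoning

select-++ : ∀ b ms ns xs ys → length ms ≡ length xs →
  select b (ms ++ ns) (xs ++ ys) ≡ select b ms xs ++ select b ns ys
select-++ b [] ns [] ys eq = refl
select-++ b (m ∷ ms) ns (x ∷ xs) ys eq with m ≟ᵇ b
... | yes _ = cong (x ∷_) (select-++ b ms ns xs ys (suc-injective eq))
... | no _ = select-++ b ms ns xs ys (suc-injective eq)

select-self : ∀ b w → select b w w ≡ replicate (occ b w) b
select-self b [] = refl
select-self false (false ∷ w) = cong (false ∷_) (select-self false w)
select-self false (true ∷ w) = select-self false w
select-self true (false ∷ w) = select-self true w
select-self true (true ∷ w) = cong (true ∷_) (select-self true w)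

select-not : ∀ b w → select b (map not w) w ≡ replicate (occ (not b) w) (not b)
select-not b [] = refl
select-not false (false ∷ w) = select-not false w
select-not false (true ∷ w) = cong (true ∷_) (select-not false w)
select-not true (false ∷ w) = cong (false ∷_) (select-not true w)
select-not true (true ∷ w) = select-not true w

select-window : ∀ b xs ys zs →
  select b (shuffle-mask xs ys zs) (xs ++ ys ++ zs) ≡
  replicate (occ (not b) xs) (not b) ++ replicate (occ b ys) b ++ replicate (occ (not b) zs) (not b)
select-window b xs ys zs = begin
  select b (map not xs ++ ys ++ map not zs) (xs ++ ys ++ zs)
    ≡⟨ select-++ b (map not xs) _ xs _ (length-map not xs) ⟩
  select b (map not xs) xs ++ select b (ys ++ map not zs) (ys ++ zs)
    ≡⟨ cong (select b (map not xs) xs ++_) (select-++ b ys _ ys _ refl) ⟩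
  select b (map not xs) xs ++ select b ys ys ++ select b (map not zs) zs
    ≡⟨ cong₂ _++_ (select-not b xs) (cong₂ _++_ (select-self b ys) (select-not b zs)) ⟩
  replicate (occ (not b) xs) (not b) ++ replicate (occ b ys) b ++ replicate (occ (not b) zs) (not b) ∎
  where open ≡-Reasoning

rotate : ℕ → List A → List A
rotate s xs = drop s xs ++ take s xs

length-rotate : ∀ s (xs : List A) → length (rotate s xs) ≡ length xs
length-rotate s xs = begin
  length (drop s xs ++ take s xs)        ≡⟨ length-++ (drop s xs) ⟩
  length (drop s xs) + length (take s xs) ≡⟨ +-comm (length (drop s xs)) _ ⟩
  length (take s xs) + length (drop s xs) ≡⟨ length-++ (take s xs) ⟨
  length (take s xs ++ drop s xs)        ≡⟨ cong length (take++drop≡id s xs) ⟩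
  length xs                              ∎
  where open ≡-Reasoning

drop-++-≤ : ∀ s (xs ys : List A) → s ≤ length xs → drop s (xs ++ ys) ≡ drop s xs ++ ys
drop-++-≤ zero xs ys _ = refl
drop-++-≤ (suc s) (x ∷ xs) ys (s≤s s≤n) = drop-++-≤ s xs ys s≤n

rotate-++-drop : ∀ s (xs : List A) → s ≤ length xs → rotate s xs ++ drop s xs ≡ drop s (xs ++ xs)
rotate-++-drop s xs s≤n = begin
  (drop s xs ++ take s xs) ++ drop s xs ≡⟨ ++-assoc (drop s xs) (take s xs) (drop s xs) ⟩
  drop s xs ++ take s xs ++ drop s xs   ≡⟨ cong (drop s xs ++_) (take++drop≡id s xs) ⟩
  drop s xs ++ xs                       ≡⟨ drop-++-≤ s xs xs s≤n ⟨
  drop s (xs ++ xs)                     ∎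
  where open ≡-Reasoning

take-length-++ : ∀ (xs ys : List A) → take (length xs) (xs ++ ys) ≡ xs
take-length-++ [] ys = refl
take-length-++ (x ∷ xs) ys = cong (x ∷_) (take-length-++ xs ys)

drop-length-++ : ∀ (xs ys : List A) → drop (length xs) (xs ++ ys) ≡ ys
drop-length-++ [] ys = refl
drop-length-++ (x ∷ xs) ys = drop-length-++ xs ys

rotate-length-++ : ∀ (xs ys : List A) → rotate (length xs) (xs ++ ys) ≡ ys ++ xs
rotate-length-++ xs ys = cong₂ _++_ (drop-length-++ xs ys) (take-length-++ xs ys)

replicate-+ : ∀ m n (x : A) → replicate (m + n) x ≡ replicate m x ++ replicate n x
replicate-+ zero n x = refl
replicate-+ (suc m) n x = cong (x ∷_) (replicate-+ m n x)

length-replicate-++ : ∀ m n (x y : A) → length (replicate m x ++ replicate n y) ≡ m + n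
length-replicate-++ m n x y =
  trans (length-++ (replicate m x)) (cong₂ _+_ (length-replicate m) (length-replicate n))

rotate-replicate : ∀ r y t w (u v : A) →
  rotate (r + y) (replicate r u ++ replicate (y + t) v ++ replicate w u) ≡
  replicate t v ++ replicate (w + r) u ++ replicate y v
rotate-replicate r y t w u v = begin
  rotate (r + y) (replicate r u ++ replicate (y + t) v ++ replicate w u)
    ≡⟨ cong₂ rotate (sym (length-replicate-++ r y u v)) split ⟩
  rotate (length front) (front ++ back)
    ≡⟨ rotate-length-++ front back ⟩
  (replicate t v ++ replicate w u) ++ replicate r u ++ replicate y v
    ≡⟨ ++-assoc (replicate t v) (replicate w u) _ ⟩
  replicate t v ++ replicate w u ++ replicate r u ++ replicate y v
    ≡⟨ cong (replicate t v ++_) (++-assoc (replicate w u) (replicate r u) _) ⟨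
  replicate t v ++ (replicate w u ++ replicate r u) ++ replicate y v
    ≡⟨ cong (λ zs → replicate t v ++ zs ++ replicate y v) (replicate-+ w r u) ⟨
  replicate t v ++ replicate (w + r) u ++ replicate y v ∎
  where
  open ≡-Reasoning
  front back : List _
  front = replicate r u ++ replicate y v
  back = replicate t v ++ replicate w u
  split : replicate r u ++ replicate (y + t) v ++ replicate w u ≡ front ++ back
  split = begin
    replicate r u ++ replicate (y + t) v ++ replicate w u
      ≡⟨ cong (λ zs → replicate r u ++ zs ++ replicate w u) (replicate-+ y t v) ⟩
    replicate r u ++ (replicate y v ++ replicate t v) ++ replicate w u
      ≡⟨ cong (replicate r u ++_) (++-assoc (replicate y v) (replicate t v) _) ⟩
    replicate r u ++ replicate y v ++ back
      ≡⟨ ++-assoc (replicate r u) (replicate y v) back ⟨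
    front ++ back ∎

-- false is a junk value past the end of the word
nth : BinWord → ℕ → Bool
nth [] _ = false
nth (x ∷ xs) zero = x
nth (x ∷ xs) (suc k) = nth xs k

nth-++ˡ : ∀ xs ys k → k < length xs → nth (xs ++ ys) k ≡ nth xs k
nth-++ˡ (x ∷ xs) ys zero _ = refl
nth-++ˡ (x ∷ xs) ys (suc k) (s≤s k<n) = nth-++ˡ xs ys k k<n

nth-++ʳ : ∀ xs ys k → nth (xs ++ ys) (length xs + k) ≡ nth ys k
nth-++ʳ [] ys k = refl
nth-++ʳ (x ∷ xs) ys k = nth-++ʳ xs ys k

nth-drop : ∀ s xs k → nth (drop s xs) k ≡ nth xs (s + k)
nth-drop zero xs k = refl
nth-drop (suc s) [] k = refl
nth-drop (suc s) (x ∷ xs) k = nth-drop s xs k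

nth-++-self : ∀ xs .{{_ : NonZero (length xs)}} j → j < length xs + length xs →
  nth (xs ++ xs) j ≡ nth xs (j % length xs)
nth-++-self xs j j<2n with j <? length xs
... | yes j<n = trans (nth-++ˡ xs xs j j<n) (cong (nth xs) (sym (m<n⇒m%n≡m j<n)))
... | no j≮n = begin
  nth (xs ++ xs) j                            ≡⟨ cong (nth (xs ++ xs)) (m+[n∸m]≡n n≤j) ⟨
  nth (xs ++ xs) (length xs + (j ∸ length xs)) ≡⟨ nth-++ʳ xs xs (j ∸ length xs) ⟩
  nth xs (j ∸ length xs)                      ≡⟨ cong (nth xs) (m<n⇒m%n≡m j∸n<n) ⟨
  nth xs ((j ∸ length xs) % length xs)        ≡⟨ cong (nth xs) (m≤n⇒[n∸m]%m≡n%m n≤j) ⟩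
  nth xs (j % length xs)                      ∎
  where
  open ≡-Reasoning
  n≤j = ≮⇒≥ j≮n
  j∸n<n : j ∸ length xs < length xs
  j∸n<n = +-cancelˡ-< (length xs) _ _ (subst (_< length xs + length xs) (sym (m+[n∸m]≡n n≤j)) j<2n)

nth-rotate : ∀ n .{{_ : NonZero n}} s xs k → length xs ≡ n → s ≤ n → k < n →
  nth (rotate s xs) k ≡ nth xs ((s + k) % n)
nth-rotate _ s xs k refl s≤n k<n = begin
  nth (rotate s xs) k                 ≡⟨ nth-++ˡ (rotate s xs) (drop s xs) k k<rotate ⟨
  nth (rotate s xs ++ drop s xs) k    ≡⟨ cong (λ ys → nth ys k) (rotate-++-drop s xs s≤n) ⟩
  nth (drop s (xs ++ xs)) k           ≡⟨ nth-drop s (xs ++ xs) k ⟩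
  nth (xs ++ xs) (s + k)              ≡⟨ nth-++-self xs (s + k) (+-mono-≤-< s≤n k<n) ⟩
  nth xs ((s + k) % length xs)        ∎
  where
  open ≡-Reasoning
  k<rotate : k < length (rotate s xs)
  k<rotate = subst (k <_) (sym (length-rotate s xs)) k<n

lookup-cast-fromList : ∀ {n} xs (p : length xs ≡ n) (k : Fin n) →
  lookup (cast p (fromList xs)) k ≡ nth xs (toℕ k)
lookup-cast-fromList {suc n} (x ∷ xs) p Fin.zero = refl
lookup-cast-fromList {suc n} (x ∷ xs) p (Fin.suc k) = lookup-cast-fromList xs (suc-injective p) k

nth-rotate≡lookup-rot : ∀ {n} s vs (q : length vs ≡ n) → s ≤ n → (k : Fin n) →
  nth (rotate s vs) (toℕ k) ≡ lookup (cast q (fromList vs)) (rot n s k)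
nth-rotate≡lookup-rot {suc n} s vs q s≤n k = begin
  nth (rotate s vs) (toℕ k)               ≡⟨ nth-rotate (suc n) s vs (toℕ k) q s≤n (toℕ<n k) ⟩
  nth vs ((s + toℕ k) % suc n)            ≡⟨ cong (nth vs) (toℕ-fromℕ< (m%n<n (s + toℕ k) (suc n))) ⟨
  nth vs (toℕ (rot (suc n) s k))          ≡⟨ lookup-cast-fromList vs q (rot (suc n) s k) ⟨
  lookup (cast q (fromList vs)) (rot (suc n) s k) ∎
  where open ≡-Reasoning

cast-fromList-rotate : ∀ n s us vs (p : length us ≡ n) (q : length vs ≡ n) → s ≤ n →
  us ≡ rotate s vs → cast p (fromList us) ≡ applyPerm (rot n s) (cast q (fromList vs))
cast-fromList-rotate n s _ vs p q s≤n refl = begin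
  cast p (fromList (rotate s vs))                      ≡⟨ tabulate∘lookup _ ⟨
  tabulate (lookup (cast p (fromList (rotate s vs))))  ≡⟨ tabulate-cong pointwise ⟩
  applyPerm (rot n s) (cast q (fromList vs))           ∎
  where
  open ≡-Reasoning
  pointwise : ∀ k → lookup (cast p (fromList (rotate s vs))) k ≡ lookup (cast q (fromList vs)) (rot n s k)
  pointwise k = trans (lookup-cast-fromList (rotate s vs) p k) (nth-rotate≡lookup-rot s vs q s≤n k)

module _ (xs ys zs : BinWord) (balanced : Balanced xs ys zs) where
  private
    x₀ = occ false xs
    x₁ = occ true xs
    z₀ = occ false zs
    z₁ = occ true zs

  length-balanced : length ys ≡ (x₀ + z₀) + (x₁ + z₁)
  length-balanced = trans (length≡occ+occ ys) (cong₂ _+_ (balanced false) (balanced true))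

  length-balanced-word : length (xs ++ ys ++ zs) ≡ length ys + length ys
  length-balanced-word = begin
    length (xs ++ ys ++ zs)               ≡⟨ length-++ xs ⟩
    length xs + length (ys ++ zs)         ≡⟨ cong (length xs +_) (length-++ ys) ⟩
    length xs + (length ys + length zs)
      ≡⟨ cong₂ (λ p q → p + (length ys + q)) (length≡occ+occ xs) (length≡occ+occ zs) ⟩
    (x₀ + x₁) + (length ys + (z₀ + z₁))   ≡⟨ x∙yz≈y∙xz (x₀ + x₁) (length ys) (z₀ + z₁) ⟩
    length ys + ((x₀ + x₁) + (z₀ + z₁))   ≡⟨ cong (length ys +_) (trans (interchange x₀ x₁ z₀ z₁) (sym length-balanced)) ⟩
    length ys + length ys                 ∎
    where open ≡-Reasoning

  select-false-balanced :
    select false (shuffle-mask xs ys zs) (xs ++ ys ++ zs) ≡ replicate x₁ true ++ replicate (z₀ + x₀) false ++ replicate z₁ true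
  select-false-balanced = trans (select-window false xs ys zs)
    (cong (λ k → replicate x₁ true ++ replicate k false ++ replicate z₁ true) (trans (balanced false) (+-comm x₀ z₀)))

  select-true-balanced :
    select true (shuffle-mask xs ys zs) (xs ++ ys ++ zs) ≡ replicate x₀ false ++ replicate (z₁ + x₁) true ++ replicate z₀ false
  select-true-balanced = trans (select-window true xs ys zs)
    (cong (λ k → replicate x₀ false ++ replicate k true ++ replicate z₀ false) (trans (balanced true) (+-comm x₁ z₁)))

  select-true≡rotate-select-false :
    select true (shuffle-mask xs ys zs) (xs ++ ys ++ zs) ≡
    rotate (x₁ + z₀) (select false (shuffle-mask xs ys zs) (xs ++ ys ++ zs))
  select-true≡rotate-select-false = trans select-true-balanced
    (sym (trans (cong (rotate (x₁ + z₀)) select-false-balanced) (rotate-replicate x₁ z₀ x₀ z₁ true false)))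

  length-select-false-balanced : length (select false (shuffle-mask xs ys zs) (xs ++ ys ++ zs)) ≡ length ys
  length-select-false-balanced = begin
    length (select false (shuffle-mask xs ys zs) (xs ++ ys ++ zs))          ≡⟨ cong length select-false-balanced ⟩
    length (replicate x₁ true ++ replicate (z₀ + x₀) false ++ replicate z₁ true) ≡⟨ length-++ (replicate x₁ true) ⟩
    length (replicate x₁ true) + length (replicate (z₀ + x₀) false ++ replicate z₁ true)
      ≡⟨ cong₂ _+_ (length-replicate x₁) (length-replicate-++ (z₀ + x₀) z₁ false true) ⟩
    x₁ + ((z₀ + x₀) + z₁)                  ≡⟨ rearrange x₀ x₁ z₀ z₁ ⟩
    (x₀ + z₀) + (x₁ + z₁)                 ≡⟨ length-balanced ⟨
    length ys                             ∎
    where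
    open ≡-Reasoning
    rearrange : ∀ a b c d → b + ((c + a) + d) ≡ (a + c) + (b + d)
    rearrange = solve-∀

  rotation-offset≤ : x₁ + z₀ ≤ length ys
  rotation-offset≤ = subst (x₁ + z₀ ≤_) (trans (+-comm (x₁ + z₁) (x₀ + z₀)) (sym length-balanced))
    (+-mono-≤ (m≤m+n x₁ z₁) (m≤n+m z₀ x₀))

  shuffleSquare-balanced : ShuffleSquare (length ys) (rot (length ys) (x₁ + z₀)) (xs ++ ys ++ zs)
  shuffleSquare-balanced =
    length-balanced-word , shuffle-mask xs ys zs , length-shuffle-mask xs ys zs ,
    length-select-true , length-select-false-balanced ,
    inj₁ (cast-fromList-rotate (length ys) (x₁ + z₀) _ _ length-select-true length-select-false-balanced
            rotation-offset≤ select-true≡rotate-select-false)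
    where
    length-select-true : length (select true (shuffle-mask xs ys zs) (xs ++ ys ++ zs)) ≡ length ys
    length-select-true = trans (cong length select-true≡rotate-select-false)
      (trans (length-rotate (x₁ + z₀) _) length-select-false-balanced)

theorem2 : (W : BinWord) → EvenWord W →
    Σ ℕ λ n → Σ (Perm n) λ γ → Cyclic n γ × ShuffleSquare n γ W
theorem2 W even with balanced-factorisation W even
... | xs , ys , zs , refl , balanced =
  length ys , rot (length ys) s , (s , λ _ → refl) , shuffleSquare-balanced xs ys zs balanced
  where s = occ true xs + occ false zs
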